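{- Let $\alpha\vDash n$ be a strong composition with $\ell(\alpha)=r$, and let $\overline\alpha$ have length $s$. Let $\{1\le j\le r:\alpha_j>1\}=\{j_1,\ldots,j_s\}$. Then \[ \deg(\alpha)=\deg(\overline\alpha)+\binom{r}{2}-s+j_1+\cdots+j_s. \]
   Context: A strong composition $\alpha\vDash n$ is a sequence of positive integers $(\alpha_1,\ldots,\alpha_r)$ summing to $n$, $\ell(\alpha)=r$. $\operatorname{coinv}(\alpha)=\#\{i<j:\alpha_i<\alpha_j\}$. If $\mu(\alpha)$ is the weakly decreasing rearrangement of $\alpha$, $b(\alpha)=\sum_i(i-1)\mu(\alpha)_i$ and $\deg(\alpha)=\operatorname{coinv}(\alpha)+2b(\alpha)-\binom{\ell(\alpha)}{2}$. $\overline\alpha$ is the (possibly empty) composition obtained from $\alpha$ by subtracting $1$ from every entry and deleting the entries that become $0$ (with $\deg$ of the empty composition equal to $0$). -}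

module Defs where

open import Data.Nat using (ℕ; zero; suc; _+_; _*_; _∸_; _<_; _<ᵇ_; _≤ᵇ_)
open import Data.Nat.Combinatorics using (_C_)
open import Data.Bool using (Bool; true; false; if_then_else_)
open import Data.List using (List; []; _∷_; length; sum; filter; map)
open import Data.List.Relation.Unary.All using (All)
open import Data.Integer as ℤ using (ℤ; +_)

IsComposition : List ℕ → Set
IsComposition α = All (λ a → 0 < a) α

countGreater : ℕ → List ℕ → ℕ
countGreater a [] = 0
countGreater a (b ∷ bs) = (if a <ᵇ b then 1 else 0) + countGreater a bs

coinv : List ℕ → ℕ
coinv [] = 0
coinv (a ∷ as) = countGreater a as + coinv as

insertDesc : ℕ → List ℕ → List ℕ
insertDesc a [] = a ∷ []
insertDesc a (b ∷ bs) = if b ≤ᵇ a then a ∷ b ∷ bs else b ∷ insertDesc a bs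

sortDesc : List ℕ → List ℕ
sortDesc [] = []
sortDesc (a ∷ as) = insertDesc a (sortDesc as)

weightedFrom : ℕ → List ℕ → ℕ
weightedFrom k [] = 0
weightedFrom k (x ∷ xs) = k * x + weightedFrom (suc k) xs

b : List ℕ → ℕ
b α = weightedFrom 0 (sortDesc α)

deg : List ℕ → ℤ
deg α = (+ coinv α) ℤ.+ (+ (2 * b α)) ℤ.- (+ (length α C 2))

bar : List ℕ → List ℕ
bar [] = []
bar (a ∷ as) with a
... | zero = bar as
... | suc zero = bar as
... | suc (suc k) = suc k ∷ bar as

-- list of 1-based positions j (starting at index k) with α_j > 1
bigPositionsFrom : ℕ → List ℕ → List ℕ
bigPositionsFrom k [] = []
bigPositionsFrom k (a ∷ as) =
  (if 1 <ᵇ a then (k ∷_) else (λ l → l)) (bigPositionsFrom (suc k) as)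

bigPositions : List ℕ → List ℕ
bigPositions α = bigPositionsFrom 1 α

{-# OPTIONS --safe #-}
module Submission where

-- Both statistics are read off column by column from the diagram of α.  Sorting
-- does not change b, and for a weakly decreasing list b = Σ_{i<j} min(α_i, α_j);
-- since min(a, c) = 1 + min(a − 1, c − 1) for a, c ≥ 1, deleting the first column
-- gives b(α) = b(ᾱ) + C(r,2).  A coinversion of α either survives in ᾱ or pairs
-- a 1 with a later entry > 1, and the entry at j_k has j_k − k ones before it, so
-- coinv(α) = coinv(ᾱ) + Σ_k (j_k − k).

open import Defs
open import Data.Nat using (ℕ)
open import Data.Nat.Combinatorics using (_C_)
open import Data.List using (List; length)
open import Data.Nat.ListAction using (sum)
open import Data.Integer as ℤ using (ℤ; +_)
open import Relation.Binary.PropositionalEquality using (_≡_)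

open import Data.Nat using (zero; suc; _+_; _*_; _⊓_; _≥_; _≤ᵇ_; _<ᵇ_; z<s)
open import Data.Nat.Properties
  using ( +-comm; +-assoc; +-suc; ⊓-comm; ⊓-zeroʳ; m≥n⇒m⊓n≡n; ≤-trans; ≰⇒≥; ≤ᵇ-reflects-≤
        ; +-commutativeSemigroup)
open import Data.Nat.Combinatorics using (nC1≡n; nCk+nC[k+1]≡[n+1]C[k+1])
open import Data.Nat.ListAction.Properties using (sum-↭)
open import Data.List using ([]; _∷_; map)
open import Data.List.Relation.Unary.All as All using (All; []; _∷_)
open import Data.List.Relation.Unary.AllPairs using (AllPairs; []; _∷_)
open import Data.List.Relation.Binary.Permutation.Propositional
  using (_↭_; refl; prep; swap; trans; ↭-sym)
open import Data.List.Relation.Binary.Permutation.Propositional.Properties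
  using (map⁺; All-resp-↭)
open import Data.Bool using (true; false; if_then_else_)
open import Relation.Nullary.Reflects using (ofʸ; ofⁿ)
open import Relation.Binary.PropositionalEquality
  using (refl; sym; cong; cong₂; module ≡-Reasoning)
import Relation.Binary.PropositionalEquality as ≡
open import Algebra.Properties.CommutativeSemigroup +-commutativeSemigroup
  using (interchange; x∙yz≈y∙xz)
import Data.Integer.Properties as ℤₚ
open import Data.Integer.Tactic.RingSolver using (solve-∀)

open ≡-Reasoning

[1+n]C2≡n+nC2 : ∀ n → suc n C 2 ≡ n + n C 2
[1+n]C2≡n+nC2 n = ≡.trans (sym (nCk+nC[k+1]≡[n+1]C[k+1] n 1)) (cong (_+ n C 2) (nC1≡n n))

insertDesc-↭ : ∀ a xs → insertDesc a xs ↭ a ∷ xs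
insertDesc-↭ a [] = refl
insertDesc-↭ a (x ∷ xs) with x ≤ᵇ a
... | true = refl
... | false = trans (prep x (insertDesc-↭ a xs)) (swap x a refl)

sortDesc-↭ : ∀ xs → sortDesc xs ↭ xs
sortDesc-↭ [] = refl
sortDesc-↭ (x ∷ xs) = trans (insertDesc-↭ x (sortDesc xs)) (prep x (sortDesc-↭ xs))

insertDesc-sorted : ∀ a {xs} → AllPairs _≥_ xs → AllPairs _≥_ (insertDesc a xs)
insertDesc-sorted a [] = [] ∷ []
insertDesc-sorted a {x ∷ xs} (x≥xs ∷ xs-sorted) with x ≤ᵇ a | ≤ᵇ-reflects-≤ x a
... | true | ofʸ x≤a = (x≤a ∷ All.map (λ y≤x → ≤-trans y≤x x≤a) x≥xs) ∷ x≥xs ∷ xs-sorted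
... | false | ofⁿ x≰a =
  All-resp-↭ (↭-sym (insertDesc-↭ a xs)) (≰⇒≥ x≰a ∷ x≥xs) ∷ insertDesc-sorted a xs-sorted

sortDesc-sorted : ∀ xs → AllPairs _≥_ (sortDesc xs)
sortDesc-sorted [] = []
sortDesc-sorted (x ∷ xs) = insertDesc-sorted x (sortDesc-sorted xs)

minSum : ℕ → List ℕ → ℕ
minSum a xs = sum (map (a ⊓_) xs)

pairwiseMinSum : List ℕ → ℕ
pairwiseMinSum [] = 0
pairwiseMinSum (x ∷ xs) = minSum x xs + pairwiseMinSum xs

minSum-↭ : ∀ a {xs ys} → xs ↭ ys → minSum a xs ≡ minSum a ys
minSum-↭ a p = sum-↭ (map⁺ (a ⊓_) p)

pairwiseMinSum-↭ : ∀ {xs ys} → xs ↭ ys → pairwiseMinSum xs ≡ pairwiseMinSum ys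
pairwiseMinSum-↭ refl = refl
pairwiseMinSum-↭ (prep x p) = cong₂ _+_ (minSum-↭ x p) (pairwiseMinSum-↭ p)
pairwiseMinSum-↭ (trans p q) = ≡.trans (pairwiseMinSum-↭ p) (pairwiseMinSum-↭ q)
pairwiseMinSum-↭ {x ∷ y ∷ xs} {_ ∷ _ ∷ ys} (swap x y p) = begin
  (x ⊓ y + minSum x xs) + (minSum y xs + pairwiseMinSum xs)
    ≡⟨ cong₂ (λ u v → (x ⊓ y + u) + (v + pairwiseMinSum xs)) (minSum-↭ x p) (minSum-↭ y p) ⟩
  (x ⊓ y + minSum x ys) + (minSum y ys + pairwiseMinSum xs)
    ≡⟨ cong₂ (λ u v → (u + minSum x ys) + (minSum y ys + v)) (⊓-comm x y) (pairwiseMinSum-↭ p) ⟩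
  (y ⊓ x + minSum x ys) + (minSum y ys + pairwiseMinSum ys)
    ≡⟨ interchange (y ⊓ x) (minSum x ys) (minSum y ys) (pairwiseMinSum ys) ⟩
  (y ⊓ x + minSum y ys) + (minSum x ys + pairwiseMinSum ys) ∎

minSum-dominated : ∀ {a xs} → All (a ≥_) xs → minSum a xs ≡ sum xs
minSum-dominated [] = refl
minSum-dominated (a≥x ∷ a≥xs) = cong₂ _+_ (m≥n⇒m⊓n≡n a≥x) (minSum-dominated a≥xs)

weightedFrom-suc : ∀ k xs → weightedFrom (suc k) xs ≡ weightedFrom k xs + sum xs
weightedFrom-suc k [] = refl
weightedFrom-suc k (x ∷ xs) = begin
  (x + k * x) + weightedFrom (suc (suc k)) xs
    ≡⟨ cong (λ t → (x + k * x) + t) (weightedFrom-suc (suc k) xs) ⟩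
  (x + k * x) + (weightedFrom (suc k) xs + sum xs)
    ≡⟨ cong (λ t → t + (weightedFrom (suc k) xs + sum xs)) (+-comm x (k * x)) ⟩
  (k * x + x) + (weightedFrom (suc k) xs + sum xs)
    ≡⟨ interchange (k * x) x (weightedFrom (suc k) xs) (sum xs) ⟩
  (k * x + weightedFrom (suc k) xs) + (x + sum xs) ∎

weightedFrom-sorted : ∀ {xs} → AllPairs _≥_ xs → weightedFrom 0 xs ≡ pairwiseMinSum xs
weightedFrom-sorted [] = refl
weightedFrom-sorted {x ∷ xs} (x≥xs ∷ xs-sorted) = begin
  weightedFrom 1 xs                      ≡⟨ weightedFrom-suc 0 xs ⟩
  weightedFrom 0 xs + sum xs             ≡⟨ cong₂ _+_ (weightedFrom-sorted xs-sorted) (sym (minSum-dominated x≥xs)) ⟩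
  pairwiseMinSum xs + minSum x xs        ≡⟨ +-comm (pairwiseMinSum xs) (minSum x xs) ⟩
  minSum x xs + pairwiseMinSum xs        ∎

b≡pairwiseMinSum : ∀ xs → b xs ≡ pairwiseMinSum xs
b≡pairwiseMinSum xs =
  ≡.trans (weightedFrom-sorted (sortDesc-sorted xs)) (pairwiseMinSum-↭ (sortDesc-↭ xs))

minSum-zero : ∀ xs → minSum 0 xs ≡ 0
minSum-zero [] = refl
minSum-zero (x ∷ xs) = minSum-zero xs

minSum-suc : ∀ c {xs} → IsComposition xs → minSum (suc c) xs ≡ minSum c (bar xs) + length xs
minSum-suc c {[]} [] = refl
minSum-suc c {suc zero ∷ xs} (_ ∷ xs⁺) = begin
  suc (c ⊓ 0) + minSum (suc c) xs           ≡⟨ cong₂ (λ u v → suc u + v) (⊓-zeroʳ c) (minSum-suc c xs⁺) ⟩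
  suc (minSum c (bar xs) + length xs)       ≡⟨ +-suc (minSum c (bar xs)) (length xs) ⟨
  minSum c (bar xs) + suc (length xs)       ∎
minSum-suc c {suc (suc m) ∷ xs} (_ ∷ xs⁺) = begin
  suc (c ⊓ suc m + minSum (suc c) xs)                   ≡⟨ cong (λ t → suc (c ⊓ suc m + t)) (minSum-suc c xs⁺) ⟩
  suc (c ⊓ suc m + (minSum c (bar xs) + length xs))     ≡⟨ cong suc (+-assoc (c ⊓ suc m) _ _) ⟨
  suc (c ⊓ suc m + minSum c (bar xs) + length xs)       ≡⟨ +-suc (c ⊓ suc m + minSum c (bar xs)) (length xs) ⟨
  c ⊓ suc m + minSum c (bar xs) + suc (length xs)       ∎

pairwiseMinSum-bar-cons : ∀ c xs → pairwiseMinSum (bar (suc c ∷ xs)) ≡ minSum c (bar xs) + pairwiseMinSum (bar xs)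
pairwiseMinSum-bar-cons zero xs = cong (_+ pairwiseMinSum (bar xs)) (sym (minSum-zero (bar xs)))
pairwiseMinSum-bar-cons (suc c) xs = refl

pairwiseMinSum-bar : ∀ {xs} → IsComposition xs → pairwiseMinSum xs ≡ pairwiseMinSum (bar xs) + length xs C 2
pairwiseMinSum-bar {[]} [] = refl
pairwiseMinSum-bar {suc c ∷ xs} (_ ∷ xs⁺) = begin
  minSum (suc c) xs + pairwiseMinSum xs
    ≡⟨ cong₂ _+_ (minSum-suc c xs⁺) (pairwiseMinSum-bar xs⁺) ⟩
  (minSum c (bar xs) + length xs) + (pairwiseMinSum (bar xs) + length xs C 2)
    ≡⟨ interchange (minSum c (bar xs)) (length xs) (pairwiseMinSum (bar xs)) (length xs C 2) ⟩
  (minSum c (bar xs) + pairwiseMinSum (bar xs)) + (length xs + length xs C 2)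
    ≡⟨ cong₂ _+_ (pairwiseMinSum-bar-cons c xs) ([1+n]C2≡n+nC2 (length xs)) ⟨
  pairwiseMinSum (bar (suc c ∷ xs)) + suc (length xs) C 2 ∎

b-bar : ∀ {xs} → IsComposition xs → b xs ≡ b (bar xs) + length xs C 2
b-bar {xs} xs⁺ = begin
  b xs                                         ≡⟨ b≡pairwiseMinSum xs ⟩
  pairwiseMinSum xs                            ≡⟨ pairwiseMinSum-bar xs⁺ ⟩
  pairwiseMinSum (bar xs) + length xs C 2      ≡⟨ cong (_+ length xs C 2) (b≡pairwiseMinSum (bar xs)) ⟨
  b (bar xs) + length xs C 2                   ∎

bar-isComposition : ∀ xs → IsComposition (bar xs)
bar-isComposition [] = []
bar-isComposition (zero ∷ xs) = bar-isComposition xs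
bar-isComposition (suc zero ∷ xs) = bar-isComposition xs
bar-isComposition (suc (suc m) ∷ xs) = z<s ∷ bar-isComposition xs

countGreater-zero : ∀ {xs} → IsComposition xs → countGreater 0 xs ≡ length xs
countGreater-zero {[]} [] = refl
countGreater-zero {suc m ∷ xs} (_ ∷ xs⁺) = cong suc (countGreater-zero xs⁺)

countGreater-bar : ∀ c xs → countGreater (suc c) xs ≡ countGreater c (bar xs)
countGreater-bar c [] = refl
countGreater-bar c (zero ∷ xs) = countGreater-bar c xs
countGreater-bar c (suc zero ∷ xs) = countGreater-bar c xs
countGreater-bar c (suc (suc m) ∷ xs) = cong (λ t → (if c <ᵇ suc m then 1 else 0) + t) (countGreater-bar c xs)

sum-bigPositionsFrom-suc : ∀ k xs →
  sum (bigPositionsFrom (suc k) xs) ≡ length (bar xs) + sum (bigPositionsFrom k xs)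
sum-bigPositionsFrom-suc k [] = refl
sum-bigPositionsFrom-suc k (zero ∷ xs) = sum-bigPositionsFrom-suc (suc k) xs
sum-bigPositionsFrom-suc k (suc zero ∷ xs) = sum-bigPositionsFrom-suc (suc k) xs
sum-bigPositionsFrom-suc k (suc (suc m) ∷ xs) = cong suc (begin
  k + sum (bigPositionsFrom (suc (suc k)) xs)
    ≡⟨ cong (λ t → k + t) (sum-bigPositionsFrom-suc (suc k) xs) ⟩
  k + (length (bar xs) + sum (bigPositionsFrom (suc k) xs))
    ≡⟨ x∙yz≈y∙xz k (length (bar xs)) (sum (bigPositionsFrom (suc k) xs)) ⟩
  length (bar xs) + (k + sum (bigPositionsFrom (suc k) xs)) ∎)

coinv-bar : ∀ {xs} → IsComposition xs →
  coinv xs + length (bar xs) C 2 ≡ coinv (bar xs) + sum (bigPositionsFrom 0 xs)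
coinv-bar {[]} [] = refl
coinv-bar {suc zero ∷ xs} (_ ∷ xs⁺) = begin
  (countGreater 1 xs + coinv xs) + s C 2
    ≡⟨ cong (λ t → (t + coinv xs) + s C 2) countGreater-one ⟩
  (s + coinv xs) + s C 2
    ≡⟨ +-assoc s (coinv xs) (s C 2) ⟩
  s + (coinv xs + s C 2)
    ≡⟨ cong (λ t → s + t) (coinv-bar xs⁺) ⟩
  s + (coinv (bar xs) + sum (bigPositionsFrom 0 xs))
    ≡⟨ x∙yz≈y∙xz s (coinv (bar xs)) (sum (bigPositionsFrom 0 xs)) ⟩
  coinv (bar xs) + (s + sum (bigPositionsFrom 0 xs))
    ≡⟨ cong (λ t → coinv (bar xs) + t) (sum-bigPositionsFrom-suc 0 xs) ⟨
  coinv (bar xs) + sum (bigPositionsFrom 1 xs) ∎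
  where
  s = length (bar xs)
  countGreater-one : countGreater 1 xs ≡ s
  countGreater-one = ≡.trans (countGreater-bar 0 xs) (countGreater-zero (bar-isComposition xs))
coinv-bar {suc (suc m) ∷ xs} (_ ∷ xs⁺) = begin
  (countGreater (suc (suc m)) xs + coinv xs) + suc s C 2
    ≡⟨ cong₂ (λ u v → (u + coinv xs) + v) (countGreater-bar (suc m) xs) ([1+n]C2≡n+nC2 s) ⟩
  (g + coinv xs) + (s + s C 2)
    ≡⟨ interchange g (coinv xs) s (s C 2) ⟩
  (g + s) + (coinv xs + s C 2)
    ≡⟨ cong (λ t → (g + s) + t) (coinv-bar xs⁺) ⟩
  (g + s) + (coinv (bar xs) + sum (bigPositionsFrom 0 xs))
    ≡⟨ interchange g s (coinv (bar xs)) (sum (bigPositionsFrom 0 xs)) ⟩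
  (g + coinv (bar xs)) + (s + sum (bigPositionsFrom 0 xs))
    ≡⟨ cong (λ t → (g + coinv (bar xs)) + t) (sum-bigPositionsFrom-suc 0 xs) ⟨
  (g + coinv (bar xs)) + sum (bigPositionsFrom 1 xs) ∎
  where
  s = length (bar xs)
  g = countGreater (suc m) (bar xs)

-- c, β, R stand for coinv, b and the binomial of α; c̄, β̄, S for those of ᾱ.
deg-shift : ∀ c c̄ β β̄ R S s J {q} → β ≡ β̄ + R → c + S ≡ c̄ + q → J ≡ s + q →
  + c ℤ.+ + (2 * β) ℤ.- + R ≡ + c̄ ℤ.+ + (2 * β̄) ℤ.- + S ℤ.+ + R ℤ.- + s ℤ.+ + J
deg-shift c c̄ _ β̄ R S s _ {q} refl h refl = begin
  + c ℤ.+ + (2 * (β̄ + R)) ℤ.- + R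
    ≡⟨ cong (λ t → + c ℤ.+ t ℤ.- + R) (≡.trans (ℤₚ.pos-* 2 (β̄ + R)) (cong (λ t → + 2 ℤ.* t) (ℤₚ.pos-+ β̄ R))) ⟩
  + c ℤ.+ + 2 ℤ.* (+ β̄ ℤ.+ + R) ℤ.- + R
    ≡⟨ separate (+ c) (+ β̄) (+ R) (+ S) ⟩
  (+ c ℤ.+ + S) ℤ.+ rest
    ≡⟨ cong (λ t → t ℤ.+ rest) (≡.trans (sym (ℤₚ.pos-+ c S)) (≡.trans (cong +_ h) (ℤₚ.pos-+ c̄ q))) ⟩
  (+ c̄ ℤ.+ + q) ℤ.+ rest
    ≡⟨ recombine (+ c̄) (+ β̄) (+ R) (+ S) (+ s) (+ q) ⟩
  + c̄ ℤ.+ + 2 ℤ.* + β̄ ℤ.- + S ℤ.+ + R ℤ.- + s ℤ.+ (+ s ℤ.+ + q)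
    ≡⟨ cong₂ (λ u v → + c̄ ℤ.+ u ℤ.- + S ℤ.+ + R ℤ.- + s ℤ.+ v) (ℤₚ.pos-* 2 β̄) (ℤₚ.pos-+ s q) ⟨
  + c̄ ℤ.+ + (2 * β̄) ℤ.- + S ℤ.+ + R ℤ.- + s ℤ.+ + (s + q) ∎
  where
  rest = + 2 ℤ.* + β̄ ℤ.- + S ℤ.+ + R
  separate : ∀ c β R S →
    c ℤ.+ + 2 ℤ.* (β ℤ.+ R) ℤ.- R ≡ (c ℤ.+ S) ℤ.+ (+ 2 ℤ.* β ℤ.- S ℤ.+ R)
  separate = solve-∀
  recombine : ∀ c β R S s q →
    (c ℤ.+ q) ℤ.+ (+ 2 ℤ.* β ℤ.- S ℤ.+ R) ≡ c ℤ.+ + 2 ℤ.* β ℤ.- S ℤ.+ R ℤ.- s ℤ.+ (s ℤ.+ q)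
  recombine = solve-∀

mainTheorem5 : (α : List ℕ) → IsComposition α →
    deg α ≡ deg (bar α) ℤ.+ (+ (length α C 2)) ℤ.- (+ length (bar α)) ℤ.+ (+ sum (bigPositions α))
mainTheorem5 α α⁺ =
  deg-shift (coinv α) (coinv (bar α)) (b α) (b (bar α)) (length α C 2) (length (bar α) C 2)
            (length (bar α)) (sum (bigPositions α))
            (b-bar α⁺) (coinv-bar α⁺) (sum-bigPositionsFrom-suc 0 α)
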